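{- For all positive integers $s$ and $k$, $$m_{\mathcal{A}_s}(k)=s \cdot m_\mathcal{A}(k)-s+1.$$
   Context: An axis-parallel strip is a set $\{(x,y)\in\mathbb{R}^2: x_0<x<x_1\}$ or $\{(x,y)\in\mathbb{R}^2: y_0<y<y_1\}$. The family $\mathcal{A}$ consists of hypergraphs $H=(V,E)$ with $V\subset\mathbb{R}^2$ finite and every edge of the form $V\cap A$ for an axis-parallel strip $A$. The family $\mathcal{A}_s$ consists of hypergraphs $H=(V,E)$ with $V\subset\mathbb{R}^2$ finite and every edge of the form $V\cap(A_1\cup\dots\cup A_s)$ for axis-parallel strips $A_1,\dots,A_s$. A polychromatic $k$-coloring of a hypergraph is a coloring of its vertices with $k$ colors such that every edge contains a vertex of each color. $H_{\ge m}$ is obtained from $H$ by deleting all edges of size less than $m$. For a hypergraph family $\mathcal{H}$, $m_{\mathcal{H}}(k)$ is the smallest positive integer $m$ such that $H_{\ge m}$ has a polychromatic $k$-coloring for every $H\in\mathcal{H}$ ($\infty$ if none exists).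
   Formalization: The vertex sets $V$ are finite subsets of ℚ² rather than of ℝ², and the axis-parallel strips have rational endpoints. -}

module Defs where

open import Data.Nat using (ℕ; suc; _≤_; _<_; _*_; _∸_; _+_)
open import Data.Rational using (ℚ) renaming (_<_ to _<ℚ_)
open import Data.Rational.Properties using () renaming (_<?_ to _<ℚ?_)
open import Data.Product using (_×_; _,_; proj₁; proj₂; ∃; ∃-syntax)
open import Data.Sum using (_⊎_)
open import Data.Fin using (Fin)
open import Data.Vec using (Vec; lookup; [_])
open import Data.Vec.Relation.Unary.Any using (Any; any?)
open import Data.List using (List; length; filter; allFin)
open import Data.List.Membership.Propositional using (_∈_)
open import Data.Maybe using (Maybe; just; nothing)
open import Function.Definitions using (Injective)
open import Relation.Binary.PropositionalEquality using (_≡_)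
open import Relation.Nullary using (¬_; Dec)
open import Relation.Nullary.Decidable using (_×-dec_)
open import Relation.Unary using (Decidable)

Point : Set
Point = ℚ × ℚ

data Strip : Set where
  vertical   : ℚ → ℚ → Strip
  horizontal : ℚ → ℚ → Strip

_∈Strip_ : Point → Strip → Set
(x , y) ∈Strip vertical x₀ x₁   = (x₀ <ℚ x) × (x <ℚ x₁)
(x , y) ∈Strip horizontal y₀ y₁ = (y₀ <ℚ y) × (y <ℚ y₁)

_∈Strip?_ : (p : Point) → (A : Strip) → Dec (p ∈Strip A)
(x , y) ∈Strip? vertical x₀ x₁   = (x₀ <ℚ? x) ×-dec (x <ℚ? x₁)
(x , y) ∈Strip? horizontal y₀ y₁ = (y₀ <ℚ? y) ×-dec (y <ℚ? y₁)

_∈Union_ : ∀ {s} → Point → Vec Strip s → Set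
p ∈Union As = Any (p ∈Strip_) As

_∈Union?_ : ∀ {s} → (p : Point) → (As : Vec Strip s) → Dec (p ∈Union As)
p ∈Union? As = any? (p ∈Strip?_) As

-- A hypergraph in 𝒜ₛ: vertex set V = {V₀,…,V_{n-1}} ⊂ ℚ² (distinct points),
-- edges given as a finite list of s-tuples of strips, edge = V ∩ (A₁ ∪ … ∪ Aₛ).
-- The vertex i belongs to the edge As:
inEdge : ∀ {n s} → Vec Point n → Vec Strip s → Fin n → Set
inEdge V As i = lookup V i ∈Union As

inEdge? : ∀ {n s} → (V : Vec Point n) → (As : Vec Strip s) → Decidable (inEdge V As)
inEdge? V As i = lookup V i ∈Union? As

edgeSize : ∀ {n s} → Vec Point n → Vec Strip s → ℕ
edgeSize {n} V As = length (filter (inEdge? V As) (allFin n))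

PolychromaticGe : ∀ {n s} (k m : ℕ) → Vec Point n → List (Vec Strip s) → (Fin n → Fin k) → Set
PolychromaticGe {n} k m V E c =
  ∀ As → As ∈ E → m ≤ edgeSize V As → ∀ (col : Fin k) → ∃[ i ] (inEdge V As i × c i ≡ col)

GoodAs : (s k m : ℕ) → Set
GoodAs s k m = ∀ (n : ℕ) (V : Vec Point n) → Injective _≡_ _≡_ (lookup V) →
  ∀ (E : List (Vec Strip s)) → ∃[ c ] PolychromaticGe {n} {s} k m V E c

GoodA : (k m : ℕ) → Set
GoodA k m = ∀ (n : ℕ) (V : Vec Point n) → Injective _≡_ _≡_ (lookup V) →
  ∀ (E : List Strip) → ∃ λ (c : Fin n → Fin k) → (∀ (A : Strip) → A ∈ E → m ≤ edgeSize V [ A ] →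
     ∀ (col : Fin k) → ∃[ i ] (inEdge V [ A ] i × c i ≡ col))

-- "v is the smallest positive integer m with P m" where v = nothing encodes ∞
-- (no positive integer works).
IsLeastPos : (ℕ → Set) → Maybe ℕ → Set
IsLeastPos P (just m) = (1 ≤ m) × P m × (∀ m′ → 1 ≤ m′ → m′ < m → ¬ P m′)
IsLeastPos P nothing  = ∀ m → 1 ≤ m → ¬ P m

formula : ℕ → Maybe ℕ → Maybe ℕ
formula s (just m) = just (s * m ∸ s + 1)
formula s nothing  = nothing

-- Upper bound: an edge of 𝒜ₛ with more than s·t vertices is a union of s strips, one of
-- which has more than t vertices, so a colouring that is polychromatic on the strips with at
-- least t + 1 vertices is polychromatic on the edges of 𝒜ₛ with at least s·t + 1 vertices.
--
-- Lower bound: if every hypergraph in 𝒜ₛ is polychromatically colourable above s·t, then so is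
-- every H ∈ 𝒜 above t. Take N = k·s + 1 copies of H translated along the diagonal so far apart
-- that a translated strip meets only its own copy, and take as edges all unions of s translated
-- strips. If, in a good colouring of this hypergraph, every copy had a strip with at least t
-- vertices missing some colour, then by pigeonhole s copies would miss the same colour, and the
-- union of their bad strips would be an edge with at least s·t vertices avoiding that colour.

{-# OPTIONS --safe #-}
module Submission where

open import Defs

open import Data.Fin as Fin using (Fin; toℕ; combine)
open import Data.Fin.Properties
  using (all?; any?; ¬∀⟶∃¬; combine-injectiveˡ; combine-injectiveʳ; combine-surjective; remQuot-combine; toℕ-injective)
open import Data.List as List using (List; []; _∷_; _++_; length; filter; allFin; concatMap; take; cartesianProductWith)
open import Data.List.Membership.Propositional using (_∈_; find; lose)
open import Data.List.Membership.Propositional.Properties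
  using (∈-∃++; ∈-++⁻; ∈-++⁺ˡ; ∈-++⁺ʳ; ∈-filter⁺; ∈-filter⁻; ∈-allFin; ∈-map⁻; ∈-concatMap⁺; ∈-concatMap⁻; ∈-cartesianProductWith⁺)
open import Data.List.Properties using (length-++; length-map; filter-none; length-tabulate; length-++-sucʳ; length-take; filter-accept)
open import Data.List.Relation.Binary.Disjoint.Propositional using (Disjoint)
open import Data.List.Relation.Binary.Sublist.Propositional.Properties using (filter⁺; filter-⊆; length-mono-≤)
open import Data.List.Relation.Binary.Subset.Propositional using (_⊆_)
open import Data.List.Relation.Unary.All as All using (All; []; _∷_)
open import Data.List.Relation.Unary.All.Properties as Allₚ using (all-filter; take⁺)
open import Data.List.Relation.Unary.AllPairs as AllPairs using (_∷_)
import Data.List.Relation.Unary.AllPairs.Properties as AllPairsₚ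
open import Data.List.Relation.Unary.Any using (here; there)
open import Data.List.Relation.Unary.Unique.Propositional using (Unique)
import Data.List.Relation.Unary.Unique.Propositional.Properties as Uniqueₚ
open import Data.Maybe using (Maybe; just; nothing)
open import Data.Nat as ℕ using (ℕ; zero; suc)
open import Data.Product using (_×_; _,_; proj₁; proj₂; ∃₂; ∃-syntax)
open import Data.Sum using (_⊎_; inj₁; inj₂; [_,_]′)
open import Data.Vec as Vec using (Vec; _∷_; [_]; lookup; toList; fromList)
open import Data.Vec.Membership.Propositional using () renaming (_∈_ to _∈ᵥ_; lose to loseᵥ)
open import Data.Vec.Membership.Propositional.Properties using (∈-toList⁺; ∈-lookup)
open import Data.Vec.Properties using (lookup∘tabulate)
import Data.Vec.Relation.Unary.All as VecAll
import Data.Vec.Relation.Unary.All.Properties as VecAllₚ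
open import Data.Vec.Relation.Unary.Any using (here; there)
import Data.Vec.Relation.Unary.Any.Properties as VecAnyₚ
open import Function using (_∘_; id)
open import Function.Definitions using (Injective)
open import Level using (Level)
open import Relation.Binary.Definitions using (DecidableEquality; tri<; tri≈; tri>)
open import Relation.Binary.PropositionalEquality using (module ≡-Reasoning; _≡_; _≢_; refl; sym; trans; cong; cong₂; subst; subst₂)
open import Relation.Nullary using (¬_; Dec; yes; no; contradiction)
open import Relation.Nullary.Decidable using (_×-dec_)
open import Relation.Unary using (Pred; Decidable)
open import Relation.Unary.Properties using (∁?)

private
  variable
    a b p q r : Level
    X : Set a
    Y : Set b

module Geometry where

  open import Data.Nat.Properties using (≤⇒≤′; <-cmp)
  open import Data.Rational as ℚ using (ℚ; 0ℚ; 1ℚ; _+_; _-_; -_; _⊓_; _⊔_; _≤_; _<_)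
  import Data.Rational.Properties as ℚ
  open import Algebra.Properties.Group ℚ.+-0-group using () renaming (∙-cancelʳ to +-cancelʳ)
  open import Data.Rational.Solver using (module +-*-Solver)

  Within : ℚ → ℚ → ℚ → Set
  Within L R x = L ≤ x × x ≤ R

  boundingInterval : (xs : List ℚ) → ∃₂ λ L R → L ≤ R × All (Within L R) xs
  boundingInterval []       = 0ℚ , 0ℚ , ℚ.≤-refl , []
  boundingInterval (x ∷ xs) with L , R , L≤R , xs-within ← boundingInterval xs =
    L ⊓ x , R ⊔ x , ℚ.≤-trans (ℚ.p⊓q≤p L x) (ℚ.≤-trans L≤R (ℚ.p≤p⊔q R x)) ,
    (ℚ.p⊓q≤q L x , ℚ.p≤q⊔p R x) ∷ All.map widen xs-within
    where
    widen : ∀ {y} → Within L R y → Within (L ⊓ x) (R ⊔ x) y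
    widen (L≤y , y≤R) = ℚ.≤-trans (ℚ.p⊓q≤p L x) L≤y , ℚ.≤-trans y≤R (ℚ.p≤p⊔q R x)

  pointCoords : Point → List ℚ
  pointCoords (x , y) = x ∷ y ∷ []

  stripEnds : Strip → List ℚ
  stripEnds (vertical a b)   = a ∷ b ∷ []
  stripEnds (horizontal a b) = a ∷ b ∷ []

  record BoundingBox {n} (V : Vec Point n) (E : List Strip) : Set where
    field
      L R           : ℚ
      L≤R           : L ≤ R
      points-within : ∀ i → All (Within L R) (pointCoords (lookup V i))
      strips-within : ∀ {A} → A ∈ E → All (Within L R) (stripEnds A)

  boundingBox : ∀ {n} (V : Vec Point n) (E : List Strip) → BoundingBox V E
  boundingBox V E
    with L , R , L≤R , within ← boundingInterval (concatMap pointCoords (toList V) ++ concatMap stripEnds E) =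
    record { L = L ; R = R ; L≤R = L≤R
           ; points-within = λ i → All.lookup points (∈-toList⁺ (∈-lookup i V))
           ; strips-within = All.lookup strips }
    where
    points : All (All (Within L R) ∘ pointCoords) (toList V)
    points = Allₚ.map⁻ (Allₚ.concat⁻ (Allₚ.++⁻ˡ _ within))
    strips : All (All (Within L R) ∘ stripEnds) E
    strips = Allₚ.map⁻ (Allₚ.concat⁻ (Allₚ.++⁻ʳ _ within))

  +-cancelʳ-< : ∀ o {a b} → a + o < b + o → a < b
  +-cancelʳ-< o {a} {b} a+o<b+o with a ℚ.<? b
  ... | yes a<b = a<b
  ... | no  a≮b = contradiction (ℚ.<-≤-trans a+o<b+o (ℚ.+-monoˡ-≤ o (ℚ.≮⇒≥ a≮b))) (ℚ.<-irrefl refl)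

  module Separation (L R : ℚ) (L≤R : L ≤ R) where

    -- gap > R − L, so the translates of the box [L, R]² by different offsets are disjoint.
    gap : ℚ
    gap = (R - L) + 1ℚ

    offset : ℕ → ℚ
    offset zero    = 0ℚ
    offset (suc j) = offset j + gap

    shiftPoint : ℕ → Point → Point
    shiftPoint j (x , y) = x + offset j , y + offset j

    shiftStrip : ℕ → Strip → Strip
    shiftStrip j (vertical a b)   = vertical (a + offset j) (b + offset j)
    shiftStrip j (horizontal a b) = horizontal (a + offset j) (b + offset j)

    p≤p+gap : ∀ p → p ≤ p + gap
    p≤p+gap p = subst (_≤ p + gap) (ℚ.+-identityʳ p) (ℚ.+-monoʳ-≤ p 0≤gap)
      where
      0≤gap : 0ℚ ≤ gap
      0≤gap = ℚ.+-mono-≤ (subst (_≤ R - L) (ℚ.+-inverseʳ L) (ℚ.+-monoˡ-≤ (- L) L≤R)) (ℚ.<⇒≤ (ℚ.positive⁻¹ 1ℚ))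

    offset-mono : ∀ {i j} → i ℕ.≤ j → offset i ≤ offset j
    offset-mono = go ∘ ≤⇒≤′
      where
      go : ∀ {i j} → i ℕ.≤′ j → offset i ≤ offset j
      go ℕ.≤′-refl        = ℚ.≤-refl
      go (ℕ.≤′-step i≤′j) = ℚ.≤-trans (go i≤′j) (p≤p+gap _)

    offset-gap : ∀ i → R + offset i < L + offset (suc i)
    offset-gap i = subst (R + offset i <_) (sym (L+[o+gap]≡R+o+1 L R (offset i))) (p<p+1 (R + offset i))
      where
      L+[o+gap]≡R+o+1 : ∀ L R o → L + (o + ((R - L) + 1ℚ)) ≡ (R + o) + 1ℚ
      L+[o+gap]≡R+o+1 = solve 3 (λ L R o → L :+ (o :+ ((R :- L) :+ con 1ℚ)) := (R :+ o) :+ con 1ℚ) refl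
        where open +-*-Solver
      p<p+1 : ∀ p → p < p + 1ℚ
      p<p+1 p = subst (_< p + 1ℚ) (ℚ.+-identityʳ p) (ℚ.+-monoʳ-< p (ℚ.positive⁻¹ 1ℚ))

    offset-separates : ∀ {i j x y} → i ℕ.< j → x ≤ R → L ≤ y → x + offset i < y + offset j
    offset-separates {i} {j} {x} {y} i<j x≤R L≤y = begin-strict
      x + offset i       ≤⟨ ℚ.+-monoˡ-≤ (offset i) x≤R ⟩
      R + offset i       <⟨ offset-gap i ⟩
      L + offset (suc i) ≤⟨ ℚ.+-mono-≤ L≤y (offset-mono i<j) ⟩
      y + offset j       ∎
      where open ℚ.≤-Reasoning

    squeezed⇒same-offset : ∀ {i j a x b} → Within L R a → Within L R x → Within L R b →
                   a + offset j ≤ x + offset i → x + offset i ≤ b + offset j → i ≡ j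
    squeezed⇒same-offset {i} {j} (L≤a , _) (L≤x , x≤R) (_ , b≤R) lo hi with <-cmp i j
    ... | tri< i<j _ _ = contradiction (ℚ.<-≤-trans (offset-separates i<j x≤R L≤a) lo) (ℚ.<-irrefl refl)
    ... | tri≈ _ i≡j _ = i≡j
    ... | tri> _ _ j<i = contradiction (ℚ.<-≤-trans (offset-separates j<i b≤R L≤x) hi) (ℚ.<-irrefl refl)

    shift-∈Strip : ∀ j {p} A → p ∈Strip A → shiftPoint j p ∈Strip shiftStrip j A
    shift-∈Strip j (vertical _ _)   (lo , hi) = ℚ.+-monoˡ-< (offset j) lo , ℚ.+-monoˡ-< (offset j) hi
    shift-∈Strip j (horizontal _ _) (lo , hi) = ℚ.+-monoˡ-< (offset j) lo , ℚ.+-monoˡ-< (offset j) hi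

    shift-∈Strip⁻ : ∀ {i j p} A → All (Within L R) (pointCoords p) → All (Within L R) (stripEnds A) →
                    shiftPoint i p ∈Strip shiftStrip j A → i ≡ j × p ∈Strip A
    shift-∈Strip⁻ {i} {j} (vertical _ _) (wx ∷ _) (wa ∷ wb ∷ []) (lo , hi)
      with refl ← squeezed⇒same-offset {i} {j} wa wx wb (ℚ.<⇒≤ lo) (ℚ.<⇒≤ hi)
      = refl , +-cancelʳ-< (offset i) lo , +-cancelʳ-< (offset i) hi
    shift-∈Strip⁻ {i} {j} (horizontal _ _) (_ ∷ wy ∷ []) (wa ∷ wb ∷ []) (lo , hi)
      with refl ← squeezed⇒same-offset {i} {j} wa wy wb (ℚ.<⇒≤ lo) (ℚ.<⇒≤ hi)
      = refl , +-cancelʳ-< (offset i) lo , +-cancelʳ-< (offset i) hi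

    shiftPoint-injective : ∀ {i j p q} → All (Within L R) (pointCoords p) → All (Within L R) (pointCoords q) →
                           shiftPoint i p ≡ shiftPoint j q → i ≡ j × p ≡ q
    shiftPoint-injective {i} {j} (wx ∷ _) (wx′ ∷ _) eq
      with refl ← squeezed⇒same-offset {i} {j} wx′ wx wx′ (ℚ.≤-reflexive (sym (cong proj₁ eq))) (ℚ.≤-reflexive (cong proj₁ eq))
      = refl , cong₂ _,_ (+-cancelʳ (offset i) _ _ (cong proj₁ eq)) (+-cancelʳ (offset i) _ _ (cong proj₂ eq))

open Geometry

open import Data.Nat using (_≤_; _<_; _+_; _*_; _∸_; z≤n; s≤s; s≤s⁻¹; _<?_; _≤?_)
open import Data.Nat.Properties
  using ( ≤-refl; ≤-trans; ≤-reflexive; <⇒≤; <-≤-trans; ≮⇒≥; n≤1+n; n<1+n; m≤n*m; m≤n⇒m⊓n≡m; m+n∸m≡n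
        ; +-comm; +-suc; *-suc; *-zeroʳ; +-mono-≤; +-monoˡ-≤; +-monoʳ-≤; +-cancelˡ-<; module ≤-Reasoning)

length-filter-∷ : {P : Pred X p} (P? : Decidable P) (x : X) (xs : List X) →
                  length (filter P? xs) ≤ length (filter P? (x ∷ xs))
length-filter-∷ P? x xs with P? x
... | yes _ = n≤1+n _
... | no  _ = ≤-refl

length-filter-∁ : {P : Pred X p} (P? : Decidable P) (xs : List X) →
                  length (filter P? xs) + length (filter (∁? P?) xs) ≡ length xs
length-filter-∁ P? []       = refl
length-filter-∁ P? (x ∷ xs) with P? x
... | yes _ = cong suc (length-filter-∁ P? xs)
... | no  _ = trans (+-suc _ _) (cong suc (length-filter-∁ P? xs))

length-filter-⊆-⊎ : {P : Pred X p} {Q : Pred X q} {R : Pred X r} (P? : Decidable P) (Q? : Decidable Q) (R? : Decidable R) →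
                    (∀ {x} → R x → P x ⊎ Q x) → (xs : List X) →
                    length (filter R? xs) ≤ length (filter P? xs) + length (filter Q? xs)
length-filter-⊆-⊎ P? Q? R? R⊆P∪Q [] = z≤n
length-filter-⊆-⊎ P? Q? R? R⊆P∪Q (x ∷ xs) with ih ← length-filter-⊆-⊎ P? Q? R? R⊆P∪Q xs | R? x
... | no _ = ≤-trans ih (+-mono-≤ (length-filter-∷ P? x xs) (length-filter-∷ Q? x xs))
... | yes Rx with R⊆P∪Q Rx
...   | inj₁ Px = begin
        suc (length (filter R? xs))                               ≤⟨ s≤s (≤-trans ih (+-monoʳ-≤ _ (length-filter-∷ Q? x xs))) ⟩
        suc (length (filter P? xs)) + length (filter Q? (x ∷ xs)) ≡⟨ cong (λ ys → length ys + _) (filter-accept P? Px) ⟨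
        length (filter P? (x ∷ xs)) + length (filter Q? (x ∷ xs)) ∎
        where open ≤-Reasoning
...   | inj₂ Qx = begin
        suc (length (filter R? xs))                               ≤⟨ s≤s (≤-trans ih (+-monoˡ-≤ _ (length-filter-∷ P? x xs))) ⟩
        suc (length (filter P? (x ∷ xs)) + length (filter Q? xs)) ≡⟨ +-suc _ _ ⟨
        length (filter P? (x ∷ xs)) + suc (length (filter Q? xs)) ≡⟨ cong (λ ys → _ + length ys) (filter-accept Q? Qx) ⟨
        length (filter P? (x ∷ xs)) + length (filter Q? (x ∷ xs)) ∎
        where open ≤-Reasoning

length-concatMap-≥ : ∀ {m} {f : X → List Y} → (∀ x → m ≤ length (f x)) → (xs : List X) →
                     length xs * m ≤ length (concatMap f xs)
length-concatMap-≥ m≤f []       = z≤n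
length-concatMap-≥ {f = f} m≤f (x ∷ xs) =
  ≤-trans (+-mono-≤ (m≤f x) (length-concatMap-≥ m≤f xs)) (≤-reflexive (sym (length-++ (f x))))

unique-⊆⇒length≤ : {xs ys : List X} → Unique xs → xs ⊆ ys → length xs ≤ length ys
unique-⊆⇒length≤ {xs = []}     _               _        = z≤n
unique-⊆⇒length≤ {xs = x ∷ xs} (x∉xs ∷ xs-uniq) x∷xs⊆ys
  with as , bs , refl ← ∈-∃++ (x∷xs⊆ys (here refl)) = begin
    suc (length xs)         ≤⟨ s≤s (unique-⊆⇒length≤ xs-uniq xs⊆as++bs) ⟩
    suc (length (as ++ bs)) ≡⟨ length-++-sucʳ as x bs ⟨
    length (as ++ x ∷ bs)   ∎
  where
  open ≤-Reasoning
  xs⊆as++bs : xs ⊆ as ++ bs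
  xs⊆as++bs y∈xs with ∈-++⁻ as (x∷xs⊆ys (there y∈xs))
  ... | inj₁ y∈as         = ∈-++⁺ˡ y∈as
  ... | inj₂ (here refl)  = contradiction refl (All.lookup x∉xs y∈xs)
  ... | inj₂ (there y∈bs) = ∈-++⁺ʳ as y∈bs

length-filter-filter : {P : Pred X p} {Q : Pred X q} (P? : Decidable P) (Q? : Decidable Q) (xs : List X) →
                       length (filter P? (filter Q? xs)) ≤ length (filter P? xs)
length-filter-filter P? Q? xs = length-mono-≤ (filter⁺ P? P? (λ { refl p → p }) (filter-⊆ Q? xs))

pigeonhole-filter : (_≟_ : DecidableEquality Y) (g : X → Y) (cs : List Y) {xs : List X} →
                    (∀ {x} → x ∈ xs → g x ∈ cs) → ∀ s → length cs * s < length xs →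
                    ∃[ c ] s < length (filter (λ x → g x ≟ c) xs)
pigeonhole-filter _≟_ g [] {x ∷ _} g∈cs s _ with () ← g∈cs (here refl)
pigeonhole-filter _≟_ g (c ∷ cs) {xs} g∈c∷cs s c∷cs*s<xs with s <? length (filter (λ x → g x ≟ c) xs)
... | yes s<|c| = c , s<|c|
... | no  s≮|c| =
  let c′ , s<|c′| = pigeonhole-filter _≟_ g cs g∈cs s cs*s<others
  in  c′ , <-≤-trans s<|c′| (length-filter-filter (λ x → g x ≟ c′) (∁? g≟c) xs)
  where
  g≟c : Decidable _
  g≟c x = g x ≟ c
  others : List _
  others = filter (∁? g≟c) xs
  g∈cs : ∀ {x} → x ∈ others → g x ∈ cs
  g∈cs x∈others with x∈xs , gx≢c ← ∈-filter⁻ (∁? g≟c) x∈others with g∈c∷cs x∈xs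
  ... | here gx≡c = contradiction gx≡c gx≢c
  ... | there gx∈cs = gx∈cs
  cs*s<others : length cs * s < length others
  cs*s<others = +-cancelˡ-< s _ _ (begin-strict
    s + length cs * s                                ≡⟨⟩
    length (c ∷ cs) * s                              <⟨ c∷cs*s<xs ⟩
    length xs                                        ≡⟨ length-filter-∁ g≟c xs ⟨
    length (filter g≟c xs) + length others           ≤⟨ +-monoˡ-≤ _ (≮⇒≥ s≮|c|) ⟩
    s + length others                                ∎)
    where open ≤-Reasoning

colour-class-of-size : ∀ {N k} s (g : Fin N → Fin k) → k * s < N →
               ∃[ col ] ∃[ js ] length js ≡ s × Unique js × All (λ j → g j ≡ col) js
colour-class-of-size {N} {k} s g k*s<N =
  let col , s<|class| = pigeonhole-filter Fin._≟_ g (allFin k) {allFin N} (λ _ → ∈-allFin _) s k*s<|allFin|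
  in  col , take s (class col) , trans (length-take s (class col)) (m≤n⇒m⊓n≡m (<⇒≤ s<|class|)) ,
      Uniqueₚ.take⁺ s (Uniqueₚ.filter⁺ (λ j → g j Fin.≟ col) (Uniqueₚ.allFin⁺ N)) ,
      take⁺ s (all-filter (λ j → g j Fin.≟ col) (allFin N))
  where
  k*s<|allFin| : length (allFin k) * s < length (allFin N)
  k*s<|allFin| = subst₂ (λ a b → a * s < b) (sym (length-tabulate {n = k} id)) (sym (length-tabulate {n = N} id)) k*s<N
  class : Fin k → List (Fin N)
  class col = filter (λ j → g j Fin.≟ col) (allFin N)

tuples : ∀ s → List X → List (Vec X s)
tuples zero    xs = Vec.[] ∷ []
tuples (suc s) xs = cartesianProductWith Vec._∷_ xs (tuples s xs)

∈-tuples : ∀ {s} {xs : List X} {v : Vec X s} → VecAll.All (_∈ xs) v → v ∈ tuples s xs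
∈-tuples VecAll.[]            = here refl
∈-tuples (x∈xs VecAll.∷ v∈xs) = ∈-cartesianProductWith⁺ Vec._∷_ x∈xs (∈-tuples v∈xs)

edgeSize-[] : ∀ {n} (V : Vec Point n) → edgeSize V Vec.[] ≡ 0
edgeSize-[] {n} V = cong length (filter-none (inEdge? V Vec.[]) (All.universal (λ _ ()) (allFin n)))

edgeSize-∷ : ∀ {n s} (V : Vec Point n) A (As : Vec Strip s) →
             edgeSize V (A ∷ As) ≤ edgeSize V [ A ] + edgeSize V As
edgeSize-∷ {n} V A As = length-filter-⊆-⊎ (inEdge? V [ A ]) (inEdge? V As) (inEdge? V (A ∷ As)) split (allFin n)
  where
  split : ∀ {i} → inEdge V (A ∷ As) i → inEdge V [ A ] i ⊎ inEdge V As i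
  split (here i∈A)   = inj₁ (here i∈A)
  split (there i∈As) = inj₂ i∈As

large-union⇒large-strip : ∀ {n s} (V : Vec Point n) t (As : Vec Strip s) → s * t < edgeSize V As →
                          ∃[ A ] A ∈ᵥ As × t < edgeSize V [ A ]
large-union⇒large-strip V t Vec.[] 0<size with () ← subst (0 <_) (edgeSize-[] V) 0<size
large-union⇒large-strip {s = suc s} V t (A ∷ As) s*t<size with t <? edgeSize V [ A ]
... | yes t<A = A , here refl , t<A
... | no  t≮A =
  let B , B∈As , t<B = large-union⇒large-strip V t As (+-cancelˡ-< t _ _ bound) in B , there B∈As , t<B
  where
  bound : t + s * t < t + edgeSize V As
  bound = begin-strict
    t + s * t                         <⟨ s*t<size ⟩
    edgeSize V (A ∷ As)               ≤⟨ edgeSize-∷ V A As ⟩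
    edgeSize V [ A ] + edgeSize V As  ≤⟨ +-monoˡ-≤ _ (≮⇒≥ t≮A) ⟩
    t + edgeSize V As                 ∎
    where open ≤-Reasoning

goodA⇒goodAs : ∀ s k t → GoodA k (suc t) → GoodAs s k (suc (s * t))
goodA⇒goodAs s k t goodA n V V-inj E with c , polyA ← goodA n V V-inj (concatMap toList E) = c , poly
  where
  poly : PolychromaticGe k (suc (s * t)) V E c
  poly As As∈E large col
    with A , A∈As , largeA ← large-union⇒large-strip V t As large
    with i , here i∈A , ci≡col ← polyA A (∈-concatMap⁺ toList (lose As∈E (∈-toList⁺ A∈As))) largeA col
    = i , loseᵥ A∈As i∈A , ci≡col

PolychromaticStrips : ∀ {n} (k m : ℕ) → Vec Point n → List Strip → (Fin n → Fin k) → Set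
PolychromaticStrips k m V E c =
  ∀ A → A ∈ E → m ≤ edgeSize V [ A ] → ∀ col → ∃[ i ] (inEdge V [ A ] i × c i ≡ col)

record MissedColour {n} (k m : ℕ) (V : Vec Point n) (E : List Strip) (c : Fin n → Fin k) : Set where
  field
    strip   : Strip
    strip∈E : strip ∈ E
    large   : m ≤ edgeSize V [ strip ]
    colour  : Fin k
    missed  : ∀ i → inEdge V [ strip ] i → c i ≢ colour

module _ {n k} (m : ℕ) (V : Vec Point n) (c : Fin n → Fin k) where

  hitsColour? : ∀ A col → Dec (∃[ i ] (inEdge V [ A ] i × c i ≡ col))
  hitsColour? A col = any? λ i → inEdge? V [ A ] i ×-dec c i Fin.≟ col

  polychromatic-or-missed : ∀ E → PolychromaticStrips k m V E c ⊎ MissedColour k m V E c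
  polychromatic-or-missed [] = inj₁ λ _ ()
  polychromatic-or-missed (A ∷ E) with polychromatic-or-missed E | m ≤? edgeSize V [ A ]
  ... | inj₂ μ | _ = inj₂ record { MissedColour μ ; strip∈E = there (MissedColour.strip∈E μ) }
  ... | inj₁ polyE | no small = inj₁ λ { _ (here refl) large → contradiction large small ; B (there B∈E) → polyE B B∈E }
  ... | inj₁ polyE | yes large with all? (hitsColour? A)
  ...   | yes hits = inj₁ λ { _ (here refl) _ → hits ; B (there B∈E) → polyE B B∈E }
  ...   | no ¬hits with col , ¬hit ← ¬∀⟶∃¬ k _ (hitsColour? A) ¬hits =
    inj₂ record { strip = A ; strip∈E = here refl ; large = large ; colour = col
                ; missed = λ i i∈A ci≡col → ¬hit (i , i∈A , ci≡col) }

  missed⇒¬polychromatic : ∀ {E} → MissedColour k m V E c → ¬ PolychromaticStrips k m V E c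
  missed⇒¬polychromatic μ poly =
    let i , i∈A , ci≡col = poly strip strip∈E large colour in missed i i∈A ci≡col
    where open MissedColour μ

  polychromatic? : ∀ E → Dec (PolychromaticStrips k m V E c)
  polychromatic? E = [ yes , no ∘ missed⇒¬polychromatic ]′ (polychromatic-or-missed E)

module Copies {n} (V : Vec Point n) (E : List Strip) (N : ℕ) where

  open BoundingBox (boundingBox V E)
  open Separation L R L≤R

  copyPoint : Fin N × Fin n → Point
  copyPoint (j , i) = shiftPoint (toℕ j) (lookup V i)

  copies : Vec Point (N * n)
  copies = Vec.tabulate (copyPoint ∘ Fin.remQuot n)

  lookup-copies : ∀ j i → lookup copies (combine j i) ≡ shiftPoint (toℕ j) (lookup V i)
  lookup-copies j i = trans (lookup∘tabulate _ (combine j i)) (cong copyPoint (remQuot-combine j i))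

  copies-injective : Injective _≡_ _≡_ (lookup V) → Injective _≡_ _≡_ (lookup copies)
  copies-injective V-inj {y} {y′} eq
    with j , i , refl ← combine-surjective {N} y | j′ , i′ , refl ← combine-surjective {N} y′
    with j≡j′ , Vi≡Vi′ ← shiftPoint-injective {toℕ j} {toℕ j′} (points-within i) (points-within i′)
                           (trans (sym (lookup-copies j i)) (trans eq (lookup-copies j′ i′)))
    = cong₂ combine (toℕ-injective {i = j} {j′} j≡j′) (V-inj Vi≡Vi′)

  shiftedStrips : List Strip
  shiftedStrips = cartesianProductWith (shiftStrip ∘ toℕ) (allFin N) E

  module _ (A : Fin N → Strip) (A∈E : ∀ j → A j ∈ E) where

    shiftedA : Fin N → Strip
    shiftedA j = shiftStrip (toℕ j) (A j)

    copy-∈Strip⁺ : ∀ {j i} → lookup V i ∈Strip A j → lookup copies (combine j i) ∈Strip shiftedA j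
    copy-∈Strip⁺ {j} {i} Vi∈Aj = subst (_∈Strip shiftedA j) (sym (lookup-copies j i)) (shift-∈Strip (toℕ j) (A j) Vi∈Aj)

    copy-∈Strip⁻ : ∀ {j} y → lookup copies y ∈Strip shiftedA j → ∃[ i ] y ≡ combine j i × lookup V i ∈Strip A j
    copy-∈Strip⁻ {j} y y∈Aj
      with j′ , i , refl ← combine-surjective {N} y
      with j′≡j , Vi∈Aj ← shift-∈Strip⁻ {toℕ j′} {toℕ j} (A j) (points-within i) (strips-within (A∈E j))
                            (subst (_∈Strip shiftedA j) (lookup-copies j′ i) y∈Aj)
      with refl ← toℕ-injective {i = j′} {j} j′≡j
      = i , refl , Vi∈Aj

    unionEdge : (js : List (Fin N)) → Vec Strip (length js)
    unionEdge js = Vec.map shiftedA (fromList js)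

    unionEdge-∈ : ∀ js → unionEdge js ∈ tuples (length js) shiftedStrips
    unionEdge-∈ js = ∈-tuples (VecAllₚ.map⁺ (VecAll.universal (λ j → ∈-cartesianProductWith⁺ _ (∈-allFin j) (A∈E j)) _))

    ∈unionEdge⁺ : ∀ {js j y} → j ∈ js → lookup copies y ∈Strip shiftedA j → inEdge copies (unionEdge js) y
    ∈unionEdge⁺ j∈js y∈Aj = VecAnyₚ.map⁺ (VecAnyₚ.fromList⁺ (lose j∈js y∈Aj))

    ∈unionEdge⁻ : ∀ {js} y → inEdge copies (unionEdge js) y →
                  ∃[ j ] j ∈ js × ∃[ i ] y ≡ combine j i × lookup V i ∈Strip A j
    ∈unionEdge⁻ y y∈union =
      let j , j∈js , y∈Aj = find (VecAnyₚ.fromList⁻ (VecAnyₚ.map⁻ y∈union)) in j , j∈js , copy-∈Strip⁻ y y∈Aj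

    block : Fin N → List (Fin (N * n))
    block j = List.map (combine j) (filter (inEdge? V [ A j ]) (allFin n))

    blocks-unique : ∀ {js} → Unique js → Unique (concatMap block js)
    blocks-unique js-unique =
      Uniqueₚ.concat⁺ (Allₚ.map⁺ (All.universal block-unique _))
                      (AllPairsₚ.map⁺ (AllPairs.map blocks-disjoint js-unique))
      where
      block-unique : ∀ j → Unique (block j)
      block-unique j = Uniqueₚ.map⁺ (combine-injectiveʳ j _ j _) (Uniqueₚ.filter⁺ _ (Uniqueₚ.allFin⁺ n))
      blocks-disjoint : ∀ {j j′} → j ≢ j′ → Disjoint (block j) (block j′)
      blocks-disjoint {j} {j′} j≢j′ (y∈j , y∈j′)
        with i , _ , refl ← ∈-map⁻ (combine j) y∈j | i′ , _ , eq ← ∈-map⁻ (combine j′) y∈j′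
        = j≢j′ (combine-injectiveˡ j i j′ i′ eq)

    blocks⊆edge : ∀ js → concatMap block js ⊆ filter (inEdge? copies (unionEdge js)) (allFin (N * n))
    blocks⊆edge js y∈blocks
      with j , j∈js , y∈j ← find (∈-concatMap⁻ block y∈blocks)
      with i , i∈Aj , refl ← ∈-map⁻ (combine j) y∈j
      with _ , here Vi∈Aj ← ∈-filter⁻ (inEdge? V [ A j ]) {xs = allFin n} i∈Aj
      = ∈-filter⁺ _ (∈-allFin _) (∈unionEdge⁺ j∈js (copy-∈Strip⁺ Vi∈Aj))

    unionEdge-size : ∀ {t} js → Unique js → (∀ j → t ≤ edgeSize V [ A j ]) →
                     length js * t ≤ edgeSize copies (unionEdge js)
    unionEdge-size {t} js js-unique large = begin
      length js * t                  ≤⟨ length-concatMap-≥ large-block js ⟩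
      length (concatMap block js)    ≤⟨ unique-⊆⇒length≤ (blocks-unique js-unique) (blocks⊆edge js) ⟩
      edgeSize copies (unionEdge js) ∎
      where
      open ≤-Reasoning
      large-block : ∀ j → t ≤ length (block j)
      large-block j = subst (t ≤_) (sym (length-map (combine j) (filter (inEdge? V [ A j ]) (allFin n)))) (large j)

    union-hits-colour : ∀ {k s t} {c : Fin (N * n) → Fin k} →
                        PolychromaticGe k (s * t) copies (tuples s shiftedStrips) c →
                        ∀ js → length js ≡ s → Unique js → (∀ j → t ≤ edgeSize V [ A j ]) →
                        ∀ col → ∃[ j ] j ∈ js × ∃[ i ] inEdge V [ A j ] i × c (combine j i) ≡ col
    union-hits-colour poly js refl js-unique large col
      with y , y∈union , cy≡col ← poly (unionEdge js) (unionEdge-∈ js) (unionEdge-size js js-unique large) col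
      with j , j∈js , i , refl , Vi∈Aj ← ∈unionEdge⁻ y y∈union
      = j , j∈js , i , here Vi∈Aj , cy≡col

  some-copy-polychromatic : ∀ {k s t} → k * s < N → (c : Fin (N * n) → Fin k) →
                            PolychromaticGe k (s * t) copies (tuples s shiftedStrips) c →
                            ∃[ j ] PolychromaticStrips k t V E (c ∘ combine j)
  some-copy-polychromatic {k} {s} {t} k*s<N c poly with any? (λ j → polychromatic? t V (c ∘ combine j) E)
  ... | yes found = found
  ... | no  none  =
    let col , js , |js|≡s , js-unique , js-miss-col = colour-class-of-size s colour k*s<N
        j , j∈js , i , i∈Aj , ci≡col = union-hits-colour strip strip∈E poly js |js|≡s js-unique large col
    in  contradiction (trans ci≡col (sym (All.lookup js-miss-col j∈js))) (missed j i i∈Aj)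
    where
    μ : ∀ j → MissedColour k t V E (c ∘ combine j)
    μ j = [ (λ poly-j → contradiction (j , poly-j) none) , id ]′ (polychromatic-or-missed t V (c ∘ combine j) E)
    open module μ j = MissedColour (μ j)

goodAs⇒goodA : ∀ s k t → GoodAs s k (s * t) → GoodA k t
goodAs⇒goodA s k t goodAs n V V-inj E =
  let c , poly = goodAs (N * n) copies (copies-injective V-inj) (tuples s shiftedStrips)
      j , poly-j = some-copy-polychromatic (n<1+n (k * s)) c poly
  in  c ∘ combine j , poly-j
  where
  N = suc (k * s)
  open Copies V E N

GoodAs-mono : ∀ {s k m m′} → m ≤ m′ → GoodAs s k m → GoodAs s k m′
GoodAs-mono m≤m′ goodAs n V V-inj E =
  let c , poly = goodAs n V V-inj E in c , λ As As∈E large → poly As As∈E (≤-trans m≤m′ large)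

s*[1+t]∸s+1≡1+s*t : ∀ s t → s * suc t ∸ s + 1 ≡ suc (s * t)
s*[1+t]∸s+1≡1+s*t s t = begin
  s * suc t ∸ s + 1   ≡⟨ cong (λ x → x ∸ s + 1) (*-suc s t) ⟩
  s + s * t ∸ s + 1   ≡⟨ cong (_+ 1) (m+n∸m≡n s (s * t)) ⟩
  s * t + 1           ≡⟨ +-comm (s * t) 1 ⟩
  suc (s * t)         ∎
  where open ≡-Reasoning

¬GoodAs-below : ∀ s k t → (∀ m → 1 ≤ m → m < suc t → ¬ GoodA k m) →
               ∀ m → 1 ≤ m → m < suc (s * t) → ¬ GoodAs s k m
¬GoodAs-below s k zero    _       m 1≤m m<1+s*0 _ = contradiction (≤-trans 1≤m (subst (m ≤_) (*-zeroʳ s) (s≤s⁻¹ m<1+s*0))) λ ()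
¬GoodAs-below s k (suc t) belowA m _   m<1+s*t  goodAs =
  belowA (suc t) (s≤s z≤n) ≤-refl (goodAs⇒goodA s k (suc t) (GoodAs-mono (s≤s⁻¹ m<1+s*t) goodAs))

theorem5 : ∀ (s k : ℕ) → 1 ≤ s → 1 ≤ k → ∀ (v : Maybe ℕ) →
    IsLeastPos (GoodA k) v → IsLeastPos (GoodAs s k) (formula s v)
theorem5 s@(suc _) k _ _ nothing noneA m 1≤m goodAs =
  noneA m 1≤m (goodAs⇒goodA s k m (GoodAs-mono (m≤n*m m s) goodAs))
theorem5 s k _ _ (just zero) (() , _)
theorem5 s k _ _ (just (suc t)) (_ , goodA , belowA) rewrite s*[1+t]∸s+1≡1+s*t s t =
  s≤s z≤n , goodA⇒goodAs s k t goodA , ¬GoodAs-below s k t belowA
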